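{- There is an $\mathrm{FP}$-formula $\varphi(x,y,y')$ that defines orders on the class of prime permutation graphs; that is, for every prime permutation graph $G=(V,E)$ there is a vertex $w\in V$ such that $\{(a,b)\in V^2\mid G\models\varphi[w,a,b]\}$ is a linear order on $V$.
   Context: $\mathrm{FP}$ is (inflationary) fixed-point logic. A graph $G=(V,E)$ is a permutation graph if there is a pair of strict linear orders $(<_1,<_2)$ on $V$ such that distinct $u,v$ are adjacent iff they occur in different order in $<_1$ and $<_2$. $G$ is prime if its only modules are $V$ and the singletons, where a module is a non-empty $M\subseteq V$ with $\{u,x\}\in E\iff\{u,x'\}\in E$ for all $u\in V\setminus M$ and $x,x'\in M$. -}

module Defs where

open import Data.Nat using (ℕ; zero; suc; _+_; _^_)
open import Data.Fin using (Fin; zero; suc; _≟_)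
open import Relation.Nullary.Decidable using (⌊_⌋)
open import Data.Bool using (Bool; true; false; _∧_; _∨_; not)
open import Data.Vec using (Vec; []; _∷_)
import Data.Vec as Vec
open import Data.List using (List; []; _∷_; allFin)
open import Data.Bool.ListAction using (any; all)
open import Data.List.Membership.Propositional using (_∈_)
open import Data.List.Relation.Unary.All using (All; lookup) renaming (_∷_ to _∷ᴬ_)
open import Data.Product using (Σ; ∃; _×_; _,_)
open import Data.Sum using (_⊎_)
open import Relation.Binary.PropositionalEquality using (_≡_; _≢_)
open import Relation.Binary.Structures using (IsStrictTotalOrder)
open import Function.Bundles using (_⇔_)

record Graph (n : ℕ) : Set where
  field
    adj     : Fin n → Fin n → Bool
    symm    : ∀ u v → adj u v ≡ adj v u
    irrefl  : ∀ u → adj u u ≡ false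
open Graph public

IsPermutationGraph : ∀ {n} → Graph n → Set₁
IsPermutationGraph {n} G =
  Σ (Fin n → Fin n → Set) λ _<₁_ →
  Σ (Fin n → Fin n → Set) λ _<₂_ →
    IsStrictTotalOrder _≡_ _<₁_ ×
    IsStrictTotalOrder _≡_ _<₂_ ×
    (∀ u v → u ≢ v →
      (adj G u v ≡ true ⇔ ((u <₁ v × v <₂ u) ⊎ (v <₁ u × u <₂ v))))

IsModule : ∀ {n} → Graph n → (Fin n → Bool) → Set
IsModule {n} G M =
  (∃ λ x → M x ≡ true) ×
  (∀ u x x' → M u ≡ false → M x ≡ true → M x' ≡ true →
     (adj G u x ≡ true ⇔ adj G u x' ≡ true))

IsPrime : ∀ {n} → Graph n → Set
IsPrime {n} G =
  ∀ M → IsModule G M →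
    (∀ v → M v ≡ true) ⊎ (∃ λ v → ∀ u → (M u ≡ true ⇔ u ≡ v))

-- Formula m Γ : formulas with m free first-order variables (de Bruijn,
-- Fin m) and free relation (second-order) variables whose arities are
-- listed in Γ.

data Formula (m : ℕ) (Γ : List ℕ) : Set where
  edge  : Fin m → Fin m → Formula m Γ
  eq    : Fin m → Fin m → Formula m Γ
  rel   : ∀ {k} → k ∈ Γ → Vec (Fin m) k → Formula m Γ
  neg   : Formula m Γ → Formula m Γ
  and   : Formula m Γ → Formula m Γ → Formula m Γ
  or    : Formula m Γ → Formula m Γ → Formula m Γ
  ex    : Formula (suc m) Γ → Formula m Γ
  all'  : Formula (suc m) Γ → Formula m Γ
  -- [ifp_{X, x₁…x_k} φ](t̄): φ has the k new first-order variables
  -- (indices 0..k-1) and the new k-ary relation variable X (head of Γ),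
  -- plus arbitrary parameters.
  ifp   : ∀ {k} → Formula (k + m) (k ∷ Γ) → Vec (Fin m) k → Formula m Γ

Env : ℕ → List ℕ → Set
Env n Γ = All (λ k → Vec (Fin n) k → Bool) Γ

extendVec : ∀ {n m k} → Vec (Fin n) k → (Fin m → Fin n) → Fin (k + m) → Fin n
extendVec []       ρ i       = ρ i
extendVec (a ∷ as) ρ zero    = a
extendVec (a ∷ as) ρ (suc i) = extendVec as ρ i

cons : ∀ {n m} → Fin n → (Fin m → Fin n) → Fin (suc m) → Fin n
cons a ρ zero    = a
cons a ρ (suc i) = ρ i

iterate : ∀ {A : Set} → ℕ → (A → A) → A → A
iterate zero    f x = x
iterate (suc i) f x = f (iterate i f x)

-- The inflationary fixed point of X ↦ X ∪ φ(X) on a structure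
-- with n elements is reached after at most n^k stages (each stage before
-- the fixed point adds a new k-tuple), so it is the stage n^k.
eval : ∀ {n m Γ} → Graph n → Formula m Γ → (Fin m → Fin n) → Env n Γ → Bool
eval G (edge x y) ρ η = adj G (ρ x) (ρ y)
eval G (eq x y)   ρ η = ⌊ ρ x ≟ ρ y ⌋
eval G (rel p ts) ρ η = lookup η p (Vec.map ρ ts)
eval G (neg φ)    ρ η = not (eval G φ ρ η)
eval G (and φ ψ)  ρ η = eval G φ ρ η ∧ eval G ψ ρ η
eval G (or φ ψ)   ρ η = eval G φ ρ η ∨ eval G ψ ρ η
eval {n} G (ex φ)   ρ η = any (λ a → eval G φ (cons a ρ) η) (allFin n)
eval {n} G (all' φ) ρ η = all (λ a → eval G φ (cons a ρ) η) (allFin n)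
eval {n} G (ifp {k} φ ts) ρ η =
  iterate (n ^ k)
    (λ X ā → X ā ∨ eval G φ (extendVec ā ρ) (X ∷ᴬ η))
    (λ _ → false)
    (Vec.map ρ ts)

-- G ⊨ φ[a, b, c] for a formula φ(x, y, y') with three free variables
-- x = var 0, y = var 1, y' = var 2.
assign3 : ∀ {n} → Fin n → Fin n → Fin n → Fin 3 → Fin n
assign3 a b c zero             = a
assign3 a b c (suc zero)       = b
assign3 a b c (suc (suc zero)) = c

Sat3 : ∀ {n} → Graph n → Formula 3 [] → Fin n → Fin n → Fin n → Set
Sat3 G φ a b c = eval G φ (assign3 a b c) All.[] ≡ true
  where import Data.List.Relation.Unary.All as All

-- Orient the edges of G, and of its complement, by Golumbic's forcing rules starting from all
-- edges at one vertex w. If G is a permutation graph realised by <₁ and <₂ and w is <₁-least,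
-- orienting along <₁ is a transitive orientation of both graphs containing the seed, and
-- transitive orientations are closed under forcing, so everything forced points along <₁.
-- Conversely, in a prime graph the vertices touched by the implication class of any edge form a
-- non-singleton module, hence contain w; since implication classes are symmetric, every edge is
-- then forced in one direction. So the forced relations of G and its complement together are
-- exactly <₁, and the forcing closure is an inflationary fixed point of a first-order formula.
module Submission where

open import Defs
open import Data.Bool using (Bool; true; false; _∧_; _∨_; not)
open import Data.Bool.Properties using (T-≡; ∧-zeroʳ; ∧-identityʳ; not-injective) renaming (_≟_ to _≟ᵇ_)
open import Data.Bool.ListAction using (any)
import Data.Bool.ListAction as ListAction
open import Data.Fin using (Fin; zero; suc; _≟_; #_)
open import Data.List using (List; []; _∷_; allFin; length; cartesianProductWith; map)
open import Data.List.Properties using (length-map; length-++; length-tabulate; map-cong)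
open import Data.List.Membership.Propositional using (_∈_; lose)
open import Data.List.Membership.Propositional.Properties using (∈-allFin; ∈-cartesianProductWith⁺)
open import Data.List.Relation.Unary.Any using (here; there; satisfied; any?)
open import Data.List.Relation.Unary.Any.Properties using (any⁺; any⁻)
open import Data.List.Relation.Unary.All using (lookup) renaming ([] to []ᴬ; _∷_ to _∷ᴬ_)
import Data.List.Extrema as Extrema
open import Data.Nat using (ℕ; zero; suc; _+_; _*_; _^_; _≤_; _<_; z≤n; s≤s)
open import Data.Nat.Properties
  using (≤-trans; ≤-reflexive; m≤n⇒m≤1+n; +-monoʳ-<; +-cancelˡ-≤; +-identityʳ; *-identityʳ; n≤0⇒n≡0)
open import Data.Product using (Σ; ∃; _×_; _,_; proj₁; proj₂; map₂)
open import Data.Sum using (_⊎_; inj₁; inj₂; [_,_]; [_,_]′)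
open import Data.Sum.Function.Propositional using (_⊎-⇔_)
open import Data.Product.Function.NonDependent.Propositional using (_×-⇔_)
open import Data.Vec using (Vec; []; _∷_)
open import Function using (_∘_; id; case_of_)
open import Function.Bundles using (_⇔_; mk⇔; Equivalence)
import Function.Properties.Equivalence as ⇔
open import Relation.Binary.Bundles using (TotalOrder)
open import Relation.Binary.Definitions using (Tri; tri<; tri≈; tri>)
open import Relation.Binary.PropositionalEquality
  using (_≡_; _≢_; refl; sym; trans; cong; cong₂; isEquivalence; module ≡-Reasoning)
open import Relation.Binary.Structures using (IsStrictTotalOrder)
import Relation.Binary.Construct.StrictToNonStrict as StrictToNonStrict
open import Relation.Nullary using (¬_; Dec; yes; no; contradiction)
open import Relation.Nullary.Decidable using (⌊_⌋; _×-dec_)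

open Equivalence using (to; from)

private
  variable
    N : ℕ

∨-true⁺ˡ : ∀ {x} y → x ≡ true → x ∨ y ≡ true
∨-true⁺ˡ y refl = refl

∨-true⁺ʳ : ∀ x {y} → y ≡ true → x ∨ y ≡ true
∨-true⁺ʳ false refl = refl
∨-true⁺ʳ true  _    = refl

∨-true⇔ : ∀ {x y} → x ∨ y ≡ true ⇔ (x ≡ true ⊎ y ≡ true)
∨-true⇔ {x} {y} = mk⇔ (elim x) [ ∨-true⁺ˡ y , ∨-true⁺ʳ x ]
  where
    elim : ∀ x → x ∨ y ≡ true → x ≡ true ⊎ y ≡ true
    elim true  _ = inj₁ refl
    elim false h = inj₂ h

not-true⇔ : ∀ {x} → not x ≡ true ⇔ (¬ x ≡ true)
not-true⇔ {false} = mk⇔ (λ _ ()) (λ _ → refl)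
not-true⇔ {true}  = mk⇔ (λ ()) (λ ¬x → contradiction refl ¬x)

⌊⌋-∧-true⇔ : ∀ {P : Set} (p? : Dec P) {x} → ⌊ p? ⌋ ∧ x ≡ true ⇔ (P × x ≡ true)
⌊⌋-∧-true⇔ (yes p) = mk⇔ (p ,_) proj₂
⌊⌋-∧-true⇔ (no ¬p) = mk⇔ (λ ()) (λ (p , _) → contradiction p ¬p)

⌊⌋-true⇔ : ∀ {P : Set} (p? : Dec P) → ⌊ p? ⌋ ≡ true ⇔ P
⌊⌋-true⇔ (yes p) = mk⇔ (λ _ → p) (λ _ → refl)
⌊⌋-true⇔ (no ¬p) = mk⇔ (λ ()) (λ p → contradiction p ¬p)

⇔-true⇒≡ : ∀ {x y} → (x ≡ true ⇔ y ≡ true) → x ≡ y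
⇔-true⇒≡ {false} {false} _ = refl
⇔-true⇒≡ {true}  {true}  _ = refl
⇔-true⇒≡ {false} {true}  h = from h refl
⇔-true⇒≡ {true}  {false} h = sym (to h refl)

≡⇒⇔-true : ∀ {x y} → x ≡ y → (x ≡ true ⇔ y ≡ true)
≡⇒⇔-true refl = ⇔.refl

any-true⁺ : ∀ {A : Set} (f : A → Bool) {x xs} → x ∈ xs → f x ≡ true → any f xs ≡ true
any-true⁺ f x∈xs fx = to T-≡ (any⁺ f (lose x∈xs (from T-≡ fx)))

any-true⁻ : ∀ {A : Set} (f : A → Bool) xs → any f xs ≡ true → ∃ λ x → f x ≡ true
any-true⁻ f xs h = map₂ (to T-≡) (satisfied (any⁻ f xs (from T-≡ h)))

any-cong : ∀ {A : Set} {f g : A → Bool} → (∀ x → f x ≡ g x) → ∀ xs → any f xs ≡ any g xs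
any-cong f≗g xs = cong ListAction.or (map-cong f≗g xs)

adj⇒≢ : ∀ (H : Graph N) {a b} → adj H a b ≡ true → a ≢ b
adj⇒≢ H {a} ab refl = contradiction (trans (sym (irrefl H a)) ab) λ ()

non-adjacent : ∀ (H : Graph N) {a b} → adj H a b ≡ false → ¬ adj H b a ≡ true
non-adjacent H {a} {b} ab ba = contradiction (trans (sym ab) (trans (symm H a b) ba)) λ ()

least : ∀ {n} {_<_ : Fin (suc n) → Fin (suc n) → Set} → IsStrictTotalOrder _≡_ _<_ →
        ∃ λ w → ∀ {b} → b ≢ w → w < b
least {n} {_<_} sto = w , λ {b} b≢w →
  [ id , (λ w≡b → contradiction (sym w≡b) b≢w) ]′ (lookup (min≤xs zero (allFin (suc n))) (∈-allFin b))
  where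
    totalOrder : TotalOrder _ _ _
    totalOrder = record
      { Carrier      = Fin (suc n)
      ; _≈_          = _≡_
      ; _≤_          = StrictToNonStrict._≤_ _≡_ _<_
      ; isTotalOrder = StrictToNonStrict.isTotalOrder _≡_ _<_ sto
      }
    open Extrema totalOrder using (min; min≤xs)

    w : Fin (suc n)
    w = min zero (allFin (suc n))

isStrictTotalOrder-⇔ : ∀ {A : Set} {_<_ _≺_ : A → A → Set} → IsStrictTotalOrder _≡_ _<_ →
                       (∀ {a b} → a ≺ b ⇔ a < b) → IsStrictTotalOrder _≡_ _≺_
isStrictTotalOrder-⇔ {_<_ = _<_} {_≺_} sto ≺⇔< = record
  { isStrictPartialOrder = record
    { isEquivalence = isEquivalence
    ; irrefl        = λ a≡b → <-irrefl a≡b ∘ to ≺⇔<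
    ; trans         = λ a≺b b≺d → from ≺⇔< (<-trans (to ≺⇔< a≺b) (to ≺⇔< b≺d))
    ; <-resp-≈      = (λ { refl a≺b → a≺b }) , (λ { refl a≺b → a≺b })
    }
  ; compare = λ a b → transfer (<-compare a b)
  }
  where
    open IsStrictTotalOrder sto using () renaming (irrefl to <-irrefl; trans to <-trans; compare to <-compare)

    transfer : ∀ {a b} → Tri (a < b) (a ≡ b) (b < a) → Tri (a ≺ b) (a ≡ b) (b ≺ a)
    transfer (tri< a<b a≢b b≮a) = tri< (from ≺⇔< a<b) a≢b (b≮a ∘ to ≺⇔<)
    transfer (tri≈ a≮b a≡b b≮a) = tri≈ (a≮b ∘ to ≺⇔<) a≡b (b≮a ∘ to ≺⇔<)
    transfer (tri> a≮b a≢b b<a) = tri> (a≮b ∘ to ≺⇔<) a≢b (from ≺⇔< b<a)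

-- Inflationary fixed points over a finite type

module InflationaryFixpoint {T : Set} (L : List T) (complete : ∀ t → t ∈ L)
  (g : (T → Bool) → T → Bool)
  (g-cong : ∀ {X Y} → (∀ t → X t ≡ Y t) → ∀ t → g X t ≡ g Y t) where

  _⊆_ : (T → Bool) → (T → Bool) → Set
  X ⊆ Y = ∀ {t} → X t ≡ true → Y t ≡ true

  Closed : (T → Bool) → Set
  Closed X = g X ⊆ X

  step : (T → Bool) → T → Bool
  step X t = X t ∨ g X t

  stage : ℕ → T → Bool
  stage i = iterate i step (λ _ → false)

  step-inflationary : ∀ X → X ⊆ step X
  step-inflationary X = ∨-true⁺ˡ _

  step-closed : ∀ {X} → Closed X → Closed (step X)
  step-closed {X} closed {t} h = step-inflationary X (closed (trans (sym (g-cong fixed t)) h))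
    where
      fixed : ∀ t → X t ∨ g X t ≡ X t
      fixed t with X t in xt
      ... | true  = refl
      ... | false with g X t in gt
      ...   | false = refl
      ...   | true  = trans (sym (closed gt)) xt

  missing : (T → Bool) → List T → ℕ
  missing X []       = 0
  missing X (t ∷ ts) with X t
  ... | true  = missing X ts
  ... | false = suc (missing X ts)

  missing-empty : ∀ ts → missing (λ _ → false) ts ≡ length ts
  missing-empty []       = refl
  missing-empty (t ∷ ts) = cong suc (missing-empty ts)

  missing-antitone : ∀ {X Y} → X ⊆ Y → ∀ ts → missing Y ts ≤ missing X ts
  missing-antitone X⊆Y [] = z≤n
  missing-antitone {X} {Y} X⊆Y (u ∷ ts) with X u in xu | Y u in yu
  ... | true  | true  = missing-antitone X⊆Y ts
  ... | true  | false = contradiction (trans (sym (X⊆Y xu)) yu) λ ()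
  ... | false | true  = m≤n⇒m≤1+n (missing-antitone X⊆Y ts)
  ... | false | false = s≤s (missing-antitone X⊆Y ts)

  missing-strict : ∀ {X Y} → X ⊆ Y → ∀ {t} ts → t ∈ ts → X t ≡ false → Y t ≡ true →
                   missing Y ts < missing X ts
  missing-strict {X} {Y} X⊆Y (u ∷ ts) (here refl) xt yt rewrite xt | yt =
    s≤s (missing-antitone X⊆Y ts)
  missing-strict {X} {Y} X⊆Y (u ∷ ts) (there t∈ts) xt yt
    with X u in xu | Y u in yu
  ... | true  | true  = missing-strict X⊆Y ts t∈ts xt yt
  ... | true  | false = contradiction (trans (sym (X⊆Y xu)) yu) λ ()
  ... | false | true  = m≤n⇒m≤1+n (missing-strict X⊆Y ts t∈ts xt yt)
  ... | false | false = s≤s (missing-strict X⊆Y ts t∈ts xt yt)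

  missing-zero : ∀ X ts → missing X ts ≡ 0 → ∀ {t} → t ∈ ts → X t ≡ true
  missing-zero X (u ∷ ts) h t∈ with X u in xu
  missing-zero X (u ∷ ts) h (here refl) | true = xu
  missing-zero X (u ∷ ts) h (there t∈) | true = missing-zero X ts h t∈

  closed-or-escaping : ∀ X → Closed X ⊎ ∃ λ t → g X t ≡ true × X t ≡ false
  closed-or-escaping X with any? (λ t → (g X t ≟ᵇ true) ×-dec (X t ≟ᵇ false)) L
  ... | yes escaping = inj₂ (satisfied escaping)
  ... | no ¬escaping = inj₁ closed
    where
      closed : Closed X
      closed {t} gt with X t in xt
      ... | true  = refl
      ... | false = contradiction (lose (complete t) (gt , xt)) ¬escaping

  closed-or-bounded : ∀ i → Closed (stage i) ⊎ i + missing (stage i) L ≤ length L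
  closed-or-bounded zero = inj₂ (≤-reflexive (missing-empty L))
  closed-or-bounded (suc i) with closed-or-bounded i
  ... | inj₁ closed = inj₁ (step-closed closed)
  ... | inj₂ bound with closed-or-escaping (stage i)
  ...   | inj₁ closed = inj₁ (step-closed closed)
  ...   | inj₂ (t , gt , xt) = inj₂ (≤-trans (+-monoʳ-< i shrinks) bound)
    where
      shrinks : missing (stage (suc i)) L < missing (stage i) L
      shrinks = missing-strict (step-inflationary (stage i)) L (complete t) xt (∨-true⁺ʳ _ gt)

  stage-closed : ∀ M → length L ≤ M → Closed (stage M)
  stage-closed M L≤M with closed-or-bounded M
  ... | inj₁ closed = closed
  ... | inj₂ bound = λ _ → missing-zero (stage M) L nothing-missing (complete _)
    where
      nothing-missing : missing (stage M) L ≡ 0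
      nothing-missing = n≤0⇒n≡0 (+-cancelˡ-≤ M _ 0
        (≤-trans bound (≤-trans L≤M (≤-reflexive (sym (+-identityʳ M))))))

  stage-induction : (P : T → Set) →
                    (∀ {X} → (∀ {t} → X t ≡ true → P t) → ∀ {t} → g X t ≡ true → P t) →
                    ∀ i {t} → stage i t ≡ true → P t
  stage-induction P g-preserves zero    ()
  stage-induction P g-preserves (suc i) h with to ∨-true⇔ h
  ... | inj₁ earlier = stage-induction P g-preserves i earlier
  ... | inj₂ new     = g-preserves (stage-induction P g-preserves i) new

-- Golumbic's forcing relation Γ

data Forced (H : Graph N) (base : Fin N → Fin N → Bool) : Fin N → Fin N → Set where
  start     : ∀ {a b} → base a b ≡ true → Forced H base a b
  same-tail : ∀ {a b d} → Forced H base a d → adj H a b ≡ true → adj H d b ≡ false → d ≢ b →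
              Forced H base a b
  same-head : ∀ {a b d} → Forced H base d b → adj H a b ≡ true → adj H a d ≡ false → a ≢ d →
              Forced H base a b

forcingCondition : ∀ {P : Set} → Bool → Bool → Bool → Dec P → Bool
forcingCondition x y z p? = (x ∧ y) ∧ (not z ∧ not ⌊ p? ⌋)

forcingCondition⁺ : ∀ {P : Set} {x y z} → x ≡ true → y ≡ true → z ≡ false → ¬ P → (p? : Dec P) →
                    forcingCondition x y z p? ≡ true
forcingCondition⁺ refl refl refl ¬p (yes p) = contradiction p ¬p
forcingCondition⁺ refl refl refl ¬p (no _)  = refl

forcingCondition⁻ : ∀ {P : Set} x y z (p? : Dec P) → forcingCondition x y z p? ≡ true →
                    x ≡ true × y ≡ true × z ≡ false × ¬ P
forcingCondition⁻ true  true  false (no ¬p) _ = refl , refl , refl , ¬p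
forcingCondition⁻ true  true  false (yes _) ()
forcingCondition⁻ true  true  true  _       ()
forcingCondition⁻ true  false _     _       ()
forcingCondition⁻ false _     _     _       ()

module _ (H : Graph N) (base : Fin N → Fin N → Bool) where

  tailCondition headCondition : (Vec (Fin N) 2 → Bool) → Fin N → Fin N → Fin N → Bool
  tailCondition X a b d = forcingCondition (X (a ∷ d ∷ [])) (adj H a b) (adj H d b) (d ≟ b)
  headCondition X a b d = forcingCondition (X (d ∷ b ∷ [])) (adj H a b) (adj H a d) (a ≟ d)

  -- Shaped exactly like the evaluation of forcingBody below, which is then equal to it by refl.
  forcingStep : (Vec (Fin N) 2 → Bool) → Vec (Fin N) 2 → Bool
  forcingStep X (a ∷ b ∷ []) =
    (base a b ∨ any (tailCondition X a b) (allFin N)) ∨ any (headCondition X a b) (allFin N)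

  forcingStep-cong : ∀ {X Y} → (∀ t → X t ≡ Y t) → ∀ t → forcingStep X t ≡ forcingStep Y t
  forcingStep-cong {X} {Y} X≗Y (a ∷ b ∷ []) =
    cong₂ _∨_ (cong (base a b ∨_) (any-cong tail (allFin N))) (any-cong head (allFin N))
    where
      tail : ∀ d → tailCondition X a b d ≡ tailCondition Y a b d
      tail d = cong (λ x → forcingCondition x (adj H a b) (adj H d b) (d ≟ b)) (X≗Y (a ∷ d ∷ []))
      head : ∀ d → headCondition X a b d ≡ headCondition Y a b d
      head d = cong (λ x → forcingCondition x (adj H a b) (adj H a d) (a ≟ d)) (X≗Y (d ∷ b ∷ []))

pairs : ∀ N → List (Vec (Fin N) 2)
pairs N = cartesianProductWith (λ a b → a ∷ b ∷ []) (allFin N) (allFin N)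

∈-pairs : ∀ (t : Vec (Fin N) 2) → t ∈ pairs N
∈-pairs (a ∷ b ∷ []) = ∈-cartesianProductWith⁺ (λ a b → a ∷ b ∷ []) (∈-allFin a) (∈-allFin b)

length-cartesianProductWith : ∀ {A B C : Set} (f : A → B → C) xs ys →
                              length (cartesianProductWith f xs ys) ≡ length xs * length ys
length-cartesianProductWith f []       ys = refl
length-cartesianProductWith f (x ∷ xs) ys =
  trans (length-++ (map (f x) ys)) (cong₂ _+_ (length-map (f x) ys) (length-cartesianProductWith f xs ys))

length-pairs : ∀ N → length (pairs N) ≡ N ^ 2
length-pairs N = begin
  length (pairs N)                          ≡⟨ length-cartesianProductWith _ (allFin N) (allFin N) ⟩
  length (allFin N) * length (allFin N)     ≡⟨ cong (λ k → k * k) (length-tabulate {n = N} id) ⟩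
  N * N                                     ≡⟨ cong (N *_) (sym (*-identityʳ N)) ⟩
  N ^ 2                                     ∎
  where open ≡-Reasoning

module _ (H : Graph N) (base : Fin N → Fin N → Bool) where

  private
    open module Stages = InflationaryFixpoint (pairs N) ∈-pairs (forcingStep H base) (forcingStep-cong H base)
      using (stage; stage-closed; stage-induction)

  forcedᵇ : Fin N → Fin N → Bool
  forcedᵇ a b = stage (N ^ 2) (a ∷ b ∷ [])

  forcedᵇ⇔ : ∀ {a b} → forcedᵇ a b ≡ true ⇔ Forced H base a b
  forcedᵇ⇔ = mk⇔ (stage-induction ForcedPair forcingStep-sound (N ^ 2)) forced-stage
    where
      ForcedPair : Vec (Fin N) 2 → Set
      ForcedPair (a ∷ b ∷ []) = Forced H base a b

      forcingStep-sound : ∀ {X} → (∀ {t} → X t ≡ true → ForcedPair t) →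
                          ∀ {t} → forcingStep H base X t ≡ true → ForcedPair t
      forcingStep-sound {X} ih {a ∷ b ∷ []} h with to ∨-true⇔ h
      ... | inj₁ h′ with to ∨-true⇔ h′
      ...   | inj₁ s = start s
      ...   | inj₂ tail =
        let d , c = any-true⁻ (tailCondition H base X a b) (allFin N) tail
            x , ab , db , d≢b = forcingCondition⁻ _ _ _ (d ≟ b) c
        in same-tail (ih x) ab db d≢b
      forcingStep-sound {X} ih {a ∷ b ∷ []} h | inj₂ head =
        let d , c = any-true⁻ (headCondition H base X a b) (allFin N) head
            x , ab , ad , a≢d = forcingCondition⁻ _ _ _ (a ≟ d) c
        in same-head (ih x) ab ad a≢d

      closed : Stages.Closed (stage (N ^ 2))
      closed = stage-closed (N ^ 2) (≤-reflexive (length-pairs N))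

      viaTail viaHead : Fin N → Fin N → Bool
      viaTail a b = any (tailCondition H base (stage (N ^ 2)) a b) (allFin N)
      viaHead a b = any (headCondition H base (stage (N ^ 2)) a b) (allFin N)

      forced-stage : ∀ {a b} → Forced H base a b → forcedᵇ a b ≡ true
      forced-stage {a} {b} (start s) = closed (∨-true⁺ˡ (viaHead a b) (∨-true⁺ˡ (viaTail a b) s))
      forced-stage {a} {b} (same-tail {d = d} f ab db d≢b) =
        closed (∨-true⁺ˡ (viaHead a b) (∨-true⁺ʳ (base a b)
          (any-true⁺ (tailCondition H base (stage (N ^ 2)) a b) (∈-allFin d)
            (forcingCondition⁺ (forced-stage f) ab db d≢b (d ≟ b)))))
      forced-stage {a} {b} (same-head {d = d} f ab ad a≢d) =
        closed (∨-true⁺ʳ (base a b ∨ viaTail a b)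
          (any-true⁺ (headCondition H base (stage (N ^ 2)) a b) (∈-allFin d)
            (forcingCondition⁺ (forced-stage f) ab ad a≢d (a ≟ d))))

record IsTransitiveOrientation (H : Graph N) (_⇒_ : Fin N → Fin N → Set) : Set where
  field
    ⇒-adj   : ∀ {a b} → a ⇒ b → adj H a b ≡ true
    adj-⇒   : ∀ {a b} → adj H a b ≡ true → a ⇒ b ⊎ b ⇒ a
    ⇒-trans : ∀ {a b d} → a ⇒ b → b ⇒ d → a ⇒ d

forced-oriented : ∀ {H : Graph N} {_⇒_} {base} → IsTransitiveOrientation H _⇒_ →
                  (∀ {a b} → base a b ≡ true → a ⇒ b) → ∀ {a b} → Forced H base a b → a ⇒ b
forced-oriented {H = H} {_⇒_} {base} o base⇒ = oriented
  where
    open IsTransitiveOrientation o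

    oriented : ∀ {a b} → Forced H base a b → a ⇒ b
    oriented (start s) = base⇒ s
    oriented (same-tail f ab db _) with adj-⇒ ab
    ... | inj₁ a⇒b = a⇒b
    ... | inj₂ b⇒a = contradiction (⇒-adj (⇒-trans b⇒a (oriented f))) (non-adjacent H db)
    oriented (same-head f ab ad _) with adj-⇒ ab
    ... | inj₁ a⇒b = a⇒b
    ... | inj₂ b⇒a = contradiction (⇒-adj (⇒-trans (oriented f) b⇒a)) (non-adjacent H ad)

-- Implication classes

pairᵇ : Fin N → Fin N → Fin N → Fin N → Bool
pairᵇ u v a b = ⌊ a ≟ u ⌋ ∧ ⌊ b ≟ v ⌋

pairᵇ⇔ : ∀ (u v a b : Fin N) → pairᵇ u v a b ≡ true ⇔ (a ≡ u × b ≡ v)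
pairᵇ⇔ u v a b = ⇔.trans (⌊⌋-∧-true⇔ (a ≟ u)) (⇔.refl ×-⇔ ⌊⌋-true⇔ (b ≟ v))

Class : Graph N → Fin N → Fin N → Fin N → Fin N → Set
Class H u v = Forced H (pairᵇ u v)

forced-adj : ∀ {H : Graph N} {base} → (∀ {a b} → base a b ≡ true → adj H a b ≡ true) →
             ∀ {a b} → Forced H base a b → adj H a b ≡ true
forced-adj base-adj (start s)            = base-adj s
forced-adj _        (same-tail _ ab _ _) = ab
forced-adj _        (same-head _ ab _ _) = ab

module _ {H : Graph N} where

  class-start : ∀ {u v} → Class H u v u v
  class-start {u} {v} = start (from (pairᵇ⇔ u v u v) (refl , refl))

  class-adj : ∀ {u v a b} → adj H u v ≡ true → Class H u v a b → adj H a b ≡ true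
  class-adj {u} {v} uv = forced-adj λ {a} {b} e → case to (pairᵇ⇔ u v a b) e of λ { (refl , refl) → uv }

  class-⊆-forced : ∀ {base a b x y} → Forced H base a b → Class H a b x y → Forced H base x y
  class-⊆-forced {a = a} {b} f (start {x} {y} e) with to (pairᵇ⇔ a b x y) e
  ... | refl , refl = f
  class-⊆-forced f (same-tail c xy dy d≢y) = same-tail (class-⊆-forced f c) xy dy d≢y
  class-⊆-forced f (same-head c xy xd x≢d) = same-head (class-⊆-forced f c) xy xd x≢d

  class-reverse : ∀ {u v a b} → Class H u v a b → Class H v u b a
  class-reverse {u} {v} (start {a} {b} e) with to (pairᵇ⇔ u v a b) e
  ... | refl , refl = class-start
  class-reverse (same-tail {a} {b} {d} c ab db d≢b) =
    same-head (class-reverse c) (trans (symm H b a) ab) (trans (symm H b d) db) (d≢b ∘ sym)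
  class-reverse (same-head {a} {b} {d} c ab ad a≢d) =
    same-tail (class-reverse c) (trans (symm H b a) ab) (trans (symm H d a) ad) (a≢d ∘ sym)

  class-sym : ∀ {u v a b} → adj H u v ≡ true → Class H u v a b → Class H a b u v
  class-sym {u} {v} uv (start {a} {b} e) with to (pairᵇ⇔ u v a b) e
  ... | refl , refl = class-start
  class-sym uv (same-tail {a} {b} {d} c ab db d≢b) =
    class-⊆-forced (same-tail class-start (class-adj uv c) (trans (symm H b d) db) (d≢b ∘ sym)) (class-sym uv c)
  class-sym uv (same-head {a} {b} {d} c ab ad a≢d) =
    class-⊆-forced (same-head class-start (class-adj uv c) (trans (symm H d a) ad) (a≢d ∘ sym)) (class-sym uv c)

  classEdgeᵇ : Fin N → Fin N → Fin N → Fin N → Bool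
  classEdgeᵇ u v x y = forcedᵇ H (pairᵇ u v) x y ∨ forcedᵇ H (pairᵇ u v) y x

  classEdge⇔ : ∀ {u v x y} → classEdgeᵇ u v x y ≡ true ⇔ (Class H u v x y ⊎ Class H u v y x)
  classEdge⇔ {u} {v} = ⇔.trans ∨-true⇔ (forcedᵇ⇔ H (pairᵇ u v) ⊎-⇔ forcedᵇ⇔ H (pairᵇ u v))

  classVertexᵇ : Fin N → Fin N → Fin N → Bool
  classVertexᵇ u v x = any (classEdgeᵇ u v x) (allFin N)

  classVertex⇔ : ∀ {u v x} → classVertexᵇ u v x ≡ true ⇔ ∃ λ y → Class H u v x y ⊎ Class H u v y x
  classVertex⇔ {u} {v} {x} = mk⇔
    (λ h → let y , e = any-true⁻ (classEdgeᵇ u v x) (allFin N) h in y , to classEdge⇔ e)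
    (λ (y , c) → any-true⁺ (classEdgeᵇ u v x) (∈-allFin y) (from classEdge⇔ c))

  module _ {u v p : Fin N} (outside : classVertexᵇ u v p ≡ false) where

    private
      inside : ∀ {x y} → Class H u v x y ⊎ Class H u v y x → classVertexᵇ u v x ≡ true
      inside c = from classVertex⇔ (_ , c)

    outsider-sees-class-alike : ∀ {a b} → Class H u v a b → adj H p a ≡ adj H p b
    outsider-sees-class-alike {a} {b} c with adj H p a in pa | adj H p b in pb
    ... | true  | true  = refl
    ... | false | false = refl
    ... | true  | false = contradiction (trans (sym outside) (inside (inj₂ class-ap))) λ ()
      where
        class-ap : Class H u v a p
        class-ap with b ≟ p
        ... | yes refl = c
        ... | no b≢p   = same-tail c (trans (symm H a p) pa) (trans (symm H b p) pb) b≢p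
    ... | false | true  = contradiction (trans (sym outside) (inside (inj₁ class-pb))) λ ()
      where
        class-pb : Class H u v p b
        class-pb with p ≟ a
        ... | yes refl = c
        ... | no p≢a   = same-head c pb pa p≢a

    outsider-sees-class-as-u : ∀ {a b} → Class H u v a b → adj H p a ≡ adj H p u
    outsider-sees-class-as-u {a} {b} (start e) with to (pairᵇ⇔ u v a b) e
    ... | refl , refl = refl
    outsider-sees-class-as-u (same-tail c _ _ _) = outsider-sees-class-as-u c
    outsider-sees-class-as-u c′@(same-head {a} {b} {d} c _ _ _) = begin
      adj H p a  ≡⟨ outsider-sees-class-alike c′ ⟩
      adj H p b  ≡⟨ outsider-sees-class-alike c ⟨
      adj H p d  ≡⟨ outsider-sees-class-as-u c ⟩
      adj H p u  ∎
      where open ≡-Reasoning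

    outsider-sees-vertex-as-u : ∀ {x} → classVertexᵇ u v x ≡ true → adj H p x ≡ adj H p u
    outsider-sees-vertex-as-u x-in with to classVertex⇔ x-in
    ... | _ , inj₁ c = outsider-sees-class-as-u c
    ... | _ , inj₂ c = trans (sym (outsider-sees-class-alike c)) (outsider-sees-class-as-u c)

  classVertex-module : ∀ {u v} → IsModule H (classVertexᵇ u v)
  classVertex-module {u} {v} =
    (u , from classVertex⇔ (v , inj₁ class-start)) , λ p x x′ outside x-in x′-in →
      ≡⇒⇔-true (trans (outsider-sees-vertex-as-u outside x-in) (sym (outsider-sees-vertex-as-u outside x′-in)))

  classVertex-all : ∀ {u v} → IsPrime H → adj H u v ≡ true → ∀ x → classVertexᵇ u v x ≡ true
  classVertex-all {u} {v} prime uv with prime _ classVertex-module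
  ... | inj₁ all = all
  ... | inj₂ (z , singleton) = contradiction (sym v≡u) (adj⇒≢ H uv)
    where
      v≡u : v ≡ u
      v≡u = trans (to (singleton v) (from classVertex⇔ (u , inj₂ class-start)))
                  (sym (to (singleton u) (from classVertex⇔ (v , inj₁ class-start))))

  forced-complete : ∀ {base w u v} → IsPrime H → (∀ {y} → adj H w y ≡ true → base w y ≡ true) →
                    adj H u v ≡ true → Forced H base u v ⊎ Forced H base v u
  forced-complete {w = w} prime seed uv with to classVertex⇔ (classVertex-all prime uv w)
  ... | y , inj₁ c = inj₁ (class-⊆-forced (start (seed (class-adj uv c))) (class-sym uv c))
  ... | y , inj₂ c = inj₂ (class-⊆-forced (start (seed (trans (symm H w y) (class-adj uv c))))
                                          (class-reverse (class-sym uv c)))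

⌊≟⌋-sym : ∀ (u v : Fin N) → ⌊ u ≟ v ⌋ ≡ ⌊ v ≟ u ⌋
⌊≟⌋-sym u v with u ≟ v | v ≟ u
... | yes _   | yes _   = refl
... | no _    | no _    = refl
... | yes u≡v | no v≢u  = contradiction (sym u≡v) v≢u
... | no u≢v  | yes v≡u = contradiction (sym v≡u) u≢v

complement : Graph N → Graph N
complement G = record
  { adj    = λ u v → not (adj G u v) ∧ not ⌊ u ≟ v ⌋
  ; symm   = λ u v → cong₂ (λ x y → not x ∧ not y) (symm G u v) (⌊≟⌋-sym u v)
  ; irrefl = λ u →
      trans (cong (λ e → not (adj G u u) ∧ not e) (from (⌊⌋-true⇔ (u ≟ u)) refl)) (∧-zeroʳ _)
  }

complement-adj : ∀ (G : Graph N) {u v} → u ≢ v → adj (complement G) u v ≡ not (adj G u v)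
complement-adj G {u} {v} u≢v with u ≟ v
... | yes u≡v = contradiction u≡v u≢v
... | no _    = ∧-identityʳ _

complement-prime : ∀ {G : Graph N} → IsPrime G → IsPrime (complement G)
complement-prime {G = G} prime M (nonempty , alike) = prime M (nonempty , alike-in-G)
  where
    alike-in-G : ∀ p x x′ → M p ≡ false → M x ≡ true → M x′ ≡ true →
                 (adj G p x ≡ true ⇔ adj G p x′ ≡ true)
    alike-in-G p x x′ p-out x-in x′-in = ≡⇒⇔-true (not-injective (begin
      not (adj G p x)            ≡⟨ complement-adj G (separated x-in) ⟨
      adj (complement G) p x     ≡⟨ ⇔-true⇒≡ (alike p x x′ p-out x-in x′-in) ⟩
      adj (complement G) p x′    ≡⟨ complement-adj G (separated x′-in) ⟩
      not (adj G p x′)           ∎))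
      where
        open ≡-Reasoning
        separated : ∀ {y} → M y ≡ true → p ≢ y
        separated y-in refl = contradiction (trans (sym p-out) y-in) λ ()

complementIf : Bool → Graph N → Graph N
complementIf false G = G
complementIf true  G = complement G

complementIf-prime : ∀ c {G : Graph N} → IsPrime G → IsPrime (complementIf c G)
complementIf-prime false prime = prime
complementIf-prime true {G} prime = complement-prime {G = G} prime

module PermutationGraph (G : Graph N) {_<₁_ _<₂_ : Fin N → Fin N → Set}
  (sto₁ : IsStrictTotalOrder _≡_ _<₁_) (sto₂ : IsStrictTotalOrder _≡_ _<₂_)
  (inversions : ∀ u v → u ≢ v → (adj G u v ≡ true ⇔ ((u <₁ v × v <₂ u) ⊎ (v <₁ u × u <₂ v)))) where

  open IsStrictTotalOrder sto₁ using ()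
    renaming (trans to <₁-trans; compare to <₁-compare; irrefl to <₁-irrefl; asym to <₁-asym)
  open IsStrictTotalOrder sto₂ using () renaming (trans to <₂-trans; compare to <₂-compare; asym to <₂-asym)

  <₁⇒≢ : ∀ {a b} → a <₁ b → a ≢ b
  <₁⇒≢ a<b refl = <₁-irrefl refl a<b

  adj⇔inverted : ∀ {a b} → a <₁ b → adj G a b ≡ true ⇔ b <₂ a
  adj⇔inverted {a} {b} a<b = mk⇔
    (λ e → [ proj₂ , (λ (b<a , _) → contradiction a<b (<₁-asym b<a)) ]
             (to (inversions a b (<₁⇒≢ a<b)) e))
    (λ b<a → from (inversions a b (<₁⇒≢ a<b)) (inj₁ (a<b , b<a)))

  complement-adj⇔ordered : ∀ {a b} → a <₁ b → adj (complement G) a b ≡ true ⇔ a <₂ b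
  complement-adj⇔ordered {a} {b} a<₁b =
    ⇔.trans (≡⇒⇔-true (complement-adj G (<₁⇒≢ a<₁b))) (⇔.trans not-true⇔ (mk⇔ ordered not-adjacent))
    where
      ordered : ¬ adj G a b ≡ true → a <₂ b
      ordered ¬ab with <₂-compare a b
      ... | tri< a<b _ _ = a<b
      ... | tri≈ _ a≡b _ = contradiction a≡b (<₁⇒≢ a<₁b)
      ... | tri> _ _ b<a = contradiction (from (adj⇔inverted a<₁b) b<a) ¬ab

      not-adjacent : a <₂ b → ¬ adj G a b ≡ true
      not-adjacent a<b ab = <₂-asym a<b (to (adj⇔inverted a<₁b) ab)

  order₂ : Bool → Fin N → Fin N → Set
  order₂ false a b = b <₂ a
  order₂ true  a b = a <₂ b

  adj⇔order₂ : ∀ c {a b} → a <₁ b → adj (complementIf c G) a b ≡ true ⇔ order₂ c a b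
  adj⇔order₂ false = adj⇔inverted
  adj⇔order₂ true  = complement-adj⇔ordered

  order₂-trans : ∀ c {a b d} → order₂ c a b → order₂ c b d → order₂ c a d
  order₂-trans false a>b b>d = <₂-trans b>d a>b
  order₂-trans true  a<b b<d = <₂-trans a<b b<d

  orientation : Bool → Fin N → Fin N → Set
  orientation c a b = a <₁ b × order₂ c a b

  orientation-transitive : ∀ c → IsTransitiveOrientation (complementIf c G) (orientation c)
  orientation-transitive c = record
    { ⇒-adj   = λ (a<b , o) → from (adj⇔order₂ c a<b) o
    ; adj-⇒   = oriented
    ; ⇒-trans = λ (a<b , o) (b<d , o′) → <₁-trans a<b b<d , order₂-trans c o o′
    }
    where
      oriented : ∀ {a b} → adj (complementIf c G) a b ≡ true → orientation c a b ⊎ orientation c b a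
      oriented {a} {b} ab with <₁-compare a b
      ... | tri< a<b _ _    = inj₁ (a<b , to (adj⇔order₂ c a<b) ab)
      ... | tri≈ _ a≡b _    = contradiction a≡b (adj⇒≢ (complementIf c G) ab)
      ... | tri> _ _ b<a    = inj₂ (b<a , to (adj⇔order₂ c b<a) (trans (symm (complementIf c G) b a) ab))

-- The defining formula

edgeIf : ∀ {m Γ} → Bool → Fin m → Fin m → Formula m Γ
edgeIf false x y = edge x y
edgeIf true  x y = and (neg (edge x y)) (neg (eq x y))

X : ∀ {m} → Fin m → Fin m → Formula m (2 ∷ [])
X x y = rel (here refl) (x ∷ y ∷ [])

-- Variables 0 and 1 are the pair (a, b) being defined and 2, 3, 4 are x, y, y';
-- under ex the witness d becomes variable 0.
forcingBody : Bool → Formula 5 (2 ∷ [])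
forcingBody c = or (or seed viaTail) viaHead
  where
    seed viaTail viaHead : Formula 5 (2 ∷ [])
    seed    = and (eq (# 0) (# 2)) (edgeIf c (# 2) (# 1))
    viaTail = ex (and (and (X (# 1) (# 0)) (edgeIf c (# 1) (# 2)))
                      (and (neg (edgeIf c (# 0) (# 2))) (neg (eq (# 0) (# 2)))))
    viaHead = ex (and (and (X (# 0) (# 2)) (edgeIf c (# 1) (# 2)))
                      (and (neg (edgeIf c (# 1) (# 0))) (neg (eq (# 1) (# 0)))))

orientationFormula : Bool → Formula 3 []
orientationFormula c = ifp (forcingBody c) (# 1 ∷ # 2 ∷ [])

orderFormula : Formula 3 []
orderFormula = or (orientationFormula false) (orientationFormula true)

seedᵇ : Graph N → Fin N → Fin N → Fin N → Bool
seedᵇ H w a b = ⌊ a ≟ w ⌋ ∧ adj H w b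

ForcedFrom : Graph N → Fin N → Fin N → Fin N → Set
ForcedFrom H w = Forced H (seedᵇ H w)

iterate-cong : ∀ {A B : Set} {F F′ : (A → B) → A → B} → (∀ X a → F X a ≡ F′ X a) →
               (∀ {X Y} → (∀ a → X a ≡ Y a) → ∀ a → F′ X a ≡ F′ Y a) →
               ∀ i x a → iterate i F x a ≡ iterate i F′ x a
iterate-cong F≗F′ F′-cong zero    x a = refl
iterate-cong F≗F′ F′-cong (suc i) x a = trans (F≗F′ _ a) (F′-cong (iterate-cong F≗F′ F′-cong i x) a)

module _ (G : Graph N) where

  eval-forcingBody : ∀ c (ρ : Fin 3 → Fin N) Y ā →
                     eval G (forcingBody c) (extendVec ā ρ) (Y ∷ᴬ []ᴬ) ≡
                     forcingStep (complementIf c G) (seedᵇ (complementIf c G) (ρ zero)) Y ā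
  eval-forcingBody false ρ Y (a ∷ b ∷ []) = refl
  eval-forcingBody true  ρ Y (a ∷ b ∷ []) = refl

  eval-orientation : ∀ c (ρ : Fin 3 → Fin N) →
                     eval G (orientationFormula c) ρ []ᴬ ≡
                     forcedᵇ (complementIf c G) (seedᵇ (complementIf c G) (ρ zero)) (ρ (# 1)) (ρ (# 2))
  eval-orientation c ρ =
    iterate-cong (λ Y ā → cong (Y ā ∨_) (eval-forcingBody c ρ Y ā))
                 (λ Y≗Z t → cong₂ _∨_ (Y≗Z t) (forcingStep-cong _ _ Y≗Z t))
                 (N ^ 2) (λ _ → false) (ρ (# 1) ∷ ρ (# 2) ∷ [])

  sat⇔forced : ∀ {w a b} → Sat3 G orderFormula w a b ⇔ (ForcedFrom G w a b ⊎ ForcedFrom (complement G) w a b)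
  sat⇔forced {w} {a} {b} =
    ⇔.trans (≡⇒⇔-true (cong₂ _∨_ (eval-orientation false ρ) (eval-orientation true ρ)))
            (⇔.trans ∨-true⇔ (forcedᵇ⇔ _ _ ⊎-⇔ forcedᵇ⇔ _ _))
    where
      ρ : Fin 3 → Fin N
      ρ = assign3 w a b

module PrimePermutationGraph {n} (G : Graph (suc n)) {_<₁_ _<₂_ : Fin (suc n) → Fin (suc n) → Set}
  (sto₁ : IsStrictTotalOrder _≡_ _<₁_) (sto₂ : IsStrictTotalOrder _≡_ _<₂_)
  (inversions : ∀ u v → u ≢ v → (adj G u v ≡ true ⇔ ((u <₁ v × v <₂ u) ⊎ (v <₁ u × u <₂ v))))
  (prime : IsPrime G) where

  open PermutationGraph G sto₁ sto₂ inversions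
  open IsStrictTotalOrder sto₁ using () renaming (asym to <₁-asym)

  w : Fin (suc n)
  w = proj₁ (least sto₁)

  seed-oriented : ∀ c {a b} → seedᵇ (complementIf c G) w a b ≡ true → orientation c a b
  seed-oriented c {a} {b} e with to (⌊⌋-∧-true⇔ (a ≟ w)) e
  ... | refl , wb = w<b , to (adj⇔order₂ c w<b) wb
    where
      w<b : w <₁ b
      w<b = proj₂ (least sto₁) (adj⇒≢ (complementIf c G) wb ∘ sym)

  forced⇒<₁ : ∀ c {a b} → ForcedFrom (complementIf c G) w a b → a <₁ b
  forced⇒<₁ c f = proj₁ (forced-oriented (orientation-transitive c) (seed-oriented c) f)

  <₁⇒forced : ∀ c {a b} → adj (complementIf c G) a b ≡ true → a <₁ b →
              ForcedFrom (complementIf c G) w a b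
  <₁⇒forced c {a} {b} ab a<b =
    [ id , (λ f → contradiction (forced⇒<₁ c f) (<₁-asym a<b)) ]′
      (forced-complete {base = seedᵇ H w} {w = w} (complementIf-prime c prime) seeded ab)
    where
      H : Graph (suc n)
      H = complementIf c G

      seeded : ∀ {y} → adj H w y ≡ true → seedᵇ H w w y ≡ true
      seeded wy = from (⌊⌋-∧-true⇔ (w ≟ w)) (refl , wy)

  sat⇔<₁ : ∀ {a b} → Sat3 G orderFormula w a b ⇔ a <₁ b
  sat⇔<₁ = ⇔.trans (sat⇔forced G) (mk⇔ [ forced⇒<₁ false , forced⇒<₁ true ] forced)
    where
      forced : ∀ {a b} → a <₁ b → ForcedFrom G w a b ⊎ ForcedFrom (complement G) w a b
      forced {a} {b} a<b with adj G a b in ab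
      ... | true  = inj₁ (<₁⇒forced false ab a<b)
      ... | false = inj₂ (<₁⇒forced true (trans (complement-adj G (<₁⇒≢ a<b)) (cong not ab)) a<b)

corollary5p8 : Σ (Formula 3 []) λ φ →
                 ∀ (n : ℕ) (G : Graph (suc n)) → IsPermutationGraph G → IsPrime G →
                   ∃ λ (w : Fin (suc n)) → IsStrictTotalOrder _≡_ (Sat3 G φ w)
corollary5p8 = orderFormula , λ n G (_ , _ , sto₁ , sto₂ , inversions) prime →
  let open PrimePermutationGraph G sto₁ sto₂ inversions prime in
  w , isStrictTotalOrder-⇔ sto₁ sat⇔<₁
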